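{- Let $S$ be a finite set and $n\ge1$. Every mapping $E$ on $S^n$ can be computed by an in situ program of length $5n-4$ and signature $1,\dots,n,n-1,\dots,1,2,\dots,n,n-1,\dots,1,2,\dots,n$. More precisely, for any $P$-factorisation $(F,I,G)$ of $E$ in which the partition-sequence $P$ has no empty member, concatenating an in situ program of $G$ with signature $1,\dots,n,\dots,1$, an in situ program of $I$ with signature $1,\dots,n$, and an in situ program of $F$ with signature $n,\dots,1,\dots,n$ (such programs exist), and then merging each pair of consecutive assignments acting on the same component into one, yields such a program. Equivalently in network terms: the multistage interconnection network $B^{ -1}|B|B^{ -1}|B|B^{ -1}$ has a routing performing $E$, and $B|B^{ -1}|B|B^{ -1}|B$ has a multicast routing performing $E^{ -1}$.
   Context: Identify $S$ with $\{0,\dots,s-1\}$, $s=|S|$. An in situ program of a mapping $E:S^n\to S^n$ is a finite sequence $(\psi_1,i_1),\dots,(\psi_m,i_m)$ with $\psi_k:S^n\to S$, $i_k\in\{1,\dots,n\}$, such that for every $X\in S^n$, setting $X_0=X$ and letting $X_k$ equal $X_{k-1}$ except that its $i_k$-th component is replaced by $\psi_k(X_{k-1})$, one has $X_m=E(X)$; its length is $m$ and its signature is $i_1,\dots,i_m$. The index of $(x_1,\dots,x_n)$ is $x_1+sx_2+\dots+s^{n-1}x_n$, and $X_i$ is the vector of index $i$. A partition-sequence of $S^n$ is a sequence $P=(P_0,\dots,P_k)$ of subsets of $S^n$ whose non-empty members form a partition of $S^n$; $I_P$ is the mapping sending $X_0,\dots,X_{s^n-1}$ in order to $|P_0|$ copies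 of $X_0$, then $|P_1|$ copies of $X_1$, ..., then $|P_k|$ copies of $X_k$. If each non-empty $P_i$ equals $E^{ -1}(y_i)$ for some $y_i\in S^n$, a $P$-factorisation of $E$ is a triple $(F,I,G)$ with $I=I_P$, $G$ a bijection of $S^n$ mapping $P_i$ onto $I^{ -1}(X_i)$ for each $i$, and $F$ a bijection of $S^n$ mapping $X_i$ to $y_i$ whenever $P_i\neq\emptyset$; then $E=F\circ I\circ G$. Networks: a multistage interconnection network (MIN) is a directed graph whose vertex set consists of stages $S_1^n,\dots,S_k^n$ (copies of $S^n$) with edges only from $S^n_i$ to $S^n_{i+1}$. The assignment network $A_i$ has two stages with edges from $(x_1,\dots,x_n)$ to $(x_1,\dots,x_{i-1},e,x_{i+1},\dots,x_n)$ for every $e\in S$. $M|M'$ denotes concatenation (identifying the last stage of $M$ with the first of $M'$). $B=A_n|\dots|A_1$ and $B^{ -1}=A_1|\dots|A_n$. A routing chooses one outgoing edge at each vertex of every non-final stage; it performs $E$ if for each $X$ in the first stage the path of chosen edges from $X$ ends at $E(X)$. A multicast routing performing $E^{ -1}$ is a choice of edges such that each vertex of every non-initial stage has exactly one chosen incoming edge and, for each $Y$ in the first stage, the set of final-stage vertices reachable from $Y$ along chosen edges is exactly $E^{ -1}(Y)$. -}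

module Defs where

open import Data.Nat using (ℕ; zero; suc; _+_; _∸_)
open import Data.Fin using (Fin; toℕ)
open import Data.Vec using (Vec; _[_]≔_)
open import Data.List using (List; []; _∷_; map; upTo; reverse; _++_; length)
open import Data.Product using (_×_; _,_; proj₂)

-- S is identified with Fin s; S^n is Vec (Fin s) n.
-- Component i ∈ {1,…,n} of the paper is the index (i-1) : Fin n.

Point : ℕ → ℕ → Set
Point s n = Vec (Fin s) n

Assignment : ℕ → ℕ → Set
Assignment s n = (Point s n → Fin s) × Fin n

Program : ℕ → ℕ → Set
Program s n = List (Assignment s n)

step : ∀ {s n} → Assignment s n → Point s n → Point s n
step (ψ , i) X = X [ i ]≔ ψ X

run : ∀ {s n} → Program s n → Point s n → Point s n
run [] X = X
run (a ∷ p) X = run p (step a X)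

signature : ∀ {s n} → Program s n → List ℕ
signature p = map (λ a → suc (toℕ (proj₂ a))) p

-- the list a, a+1, …, b  (empty if b < a)
range : ℕ → ℕ → List ℕ
range a b = map (a +_) (upTo (suc b ∸ a))

targetSignature : ℕ → List ℕ
targetSignature n =
  range 1 n ++ reverse (range 1 (n ∸ 1)) ++ range 2 n
  ++ reverse (range 1 (n ∸ 1)) ++ range 2 n

-- Write E = F ∘ I ∘ G, where G and F are bijections of Sⁿ and I maps the j-th point (in index
-- order) to the h j-th one for some h with h 0 = 0 and increments 0 or 1: G sorts the points by
-- their images, I collapses each fibre of E to a single point, and F sends these points to the
-- values of E.  A bijection has an in situ program with signature 1,…,n,…,1 by Beneš' recursion,
-- whose step is König's theorem that the s-regular bipartite multigraph of a bijection of
-- S × Sⁿ⁻¹ is properly edge-coloured with s colours (proved by Kempe-chain swaps that lower the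
-- number of repeated colours at the vertices); mirroring the components gives n,…,1,…,n.  The
-- map I is computed digit by digit with signature 1,…,n.  Concatenating the programs for G, I
-- and F and merging the adjacent assignments to component 1 and to component n leaves 5n − 4
-- assignments.

module Submission where

open import Defs
open import Data.Bool.Base using (if_then_else_)
open import Data.Empty using (⊥-elim)
open import Data.Fin.Base using (Fin; zero; suc; toℕ; fromℕ; fromℕ<; inject₁; opposite; punchIn; punchOut)
open import Data.Fin.Permutation.Components using (transpose; transpose-inverse)
open import Data.Fin.Properties
  using (_≟_; any?; all?; ¬∀⟶∃¬; pigeonhole; toℕ<n; toℕ-fromℕ; toℕ-fromℕ<; toℕ-injective; opposite-involutive;
         opposite-suc; punchIn-injective; punchInᵢ≢i; punchIn-punchOut; punchOut-injective)
open import Data.List.Base using (List; []; _∷_; _++_; _∷ʳ_; map; reverse; length; applyUpTo)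
import Data.List.Base as List
open import Data.List.Membership.Propositional.Properties using (∈-∃++; ∈-lookup)
open import Data.List.Properties
  using (map-∘; map-++; map-cong; ++-assoc; reverse-++; unfold-reverse; reverse-map; length-++; length-map;
         length-reverse; ∷-injectiveʳ; map-applyUpTo)
open import Data.List.Relation.Unary.All as All using (All; []; _∷_)
open import Data.List.Relation.Unary.All.Properties using (¬Any⇒All¬)
open import Data.List.Relation.Unary.Unique.Propositional using (Unique; []; _∷_)
open import Data.Nat.Base
open import Data.Nat.DivMod
open import Data.Nat.Induction using (<-wellFounded)
open import Data.Nat.Properties hiding (_≟_)
open import Data.Product using (Σ; Σ-syntax; ∃-syntax; ∃₂; _×_; _,_; proj₁; proj₂)
open import Data.Product.Properties using (,-injective; ×-≡,≡→≡)
open import Data.Sum.Base using (_⊎_; inj₁; inj₂)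
open import Data.Vec.Base using (Vec; []; _∷_; head; tail; lookup; _[_]≔_)
import Data.Vec.Base as Vec
open import Data.Vec.Functional using (removeAt)
open import Data.Vec.Properties
  using (∷-injective; []≔-idempotent; lookup∘tabulate; tabulate∘lookup; tabulate-cong; lookup∘update; lookup∘update′)
open import Function.Base using (id; _∘_)
open import Function.Definitions using (Injective; StrictlySurjective; StrictlyInverseˡ; StrictlyInverseʳ)
open import Induction.WellFounded using (Acc; acc)
open import Relation.Binary.Definitions using (tri<; tri≈; tri>)
open import Relation.Binary.PropositionalEquality
open import Relation.Nullary using (Dec; yes; no; does; ¬_; ¬?; contradiction)
open import Relation.Nullary.Decidable using (map′; _×-dec_; _⊎-dec_; decidable-stable; dec-true; dec-false)
open import Relation.Unary using (Pred; Decidable; _⊆_)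

open import Algebra.Properties.CommutativeSemigroup +-commutativeSemigroup using (x∙yz≈y∙xz; xy∙z≈xz∙y)
open import Algebra.Properties.Semiring.Sum +-*-semiring
  using (sum; sum-cong-≗; ∑-distrib-+; ∑-comm; *-distribˡ-sum; sum-remove; sum-replicate-zero)

𝟙 : ∀ {a} {A : Set a} → Dec A → ℕ
𝟙 d = if does d then 1 else 0

module _ {a} {A : Set a} where

  𝟙-yes : (d : Dec A) → A → 𝟙 d ≡ 1
  𝟙-yes (yes _) _ = refl
  𝟙-yes (no ¬a) a = contradiction a ¬a

  𝟙-no : (d : Dec A) → ¬ A → 𝟙 d ≡ 0
  𝟙-no (yes a) ¬a = contradiction a ¬a
  𝟙-no (no _)  _  = refl

𝟙-mono : ∀ {a b} {A : Set a} {B : Set b} → (A → B) → (d : Dec A) (e : Dec B) → 𝟙 d ≤ 𝟙 e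
𝟙-mono A→B (yes a) e = ≤-reflexive (sym (𝟙-yes e (A→B a)))
𝟙-mono A→B (no _)  e = z≤n

sum-mono : ∀ {n} {f g : Fin n → ℕ} → (∀ i → f i ≤ g i) → sum f ≤ sum g
sum-mono {zero}  f≤g = z≤n
sum-mono {suc n} f≤g = +-mono-≤ (f≤g zero) (sum-mono (f≤g ∘ suc))

sum-mono-< : ∀ {n} {f g : Fin n → ℕ} → (∀ i → f i ≤ g i) → ∀ j → f j < g j → sum f < sum g
sum-mono-< f≤g zero    fj<gj = +-mono-<-≤ fj<gj (sum-mono (f≤g ∘ suc))
sum-mono-< f≤g (suc j) fj<gj = +-mono-≤-< (f≤g zero) (sum-mono-< (f≤g ∘ suc) j fj<gj)

sum-ones : ∀ n → sum {n} (λ _ → 1) ≡ n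
sum-ones zero    = refl
sum-ones (suc n) = cong suc (sum-ones n)

sum-sift : ∀ {n} (i : Fin n) (g : Fin n → ℕ) → sum (λ j → 𝟙 (i ≟ j) * g j) ≡ g i
sum-sift {suc n} zero    g = trans (cong₂ _+_ (+-identityʳ (g zero)) (sum-replicate-zero n)) (+-identityʳ (g zero))
sum-sift {suc n} (suc i) g = sum-sift i (g ∘ suc)

sum-<-two-points : ∀ {n} {f g : Fin n → ℕ} {α β : Fin n} → α ≢ β →
                   (∀ c → c ≢ α → c ≢ β → f c ≡ g c) → f α + f β < g α + g β → sum f < sum g
sum-<-two-points {suc zero} {α = zero} {zero} α≢β _ _ = contradiction refl α≢β
sum-<-two-points {suc (suc n)} {f} {g} {α} {β} α≢β rest fαβ<gαβ = begin-strict
  sum f                  ≡⟨ split f ⟩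
  f α + f β + sum (R f)  <⟨ +-monoˡ-< (sum (R f)) fαβ<gαβ ⟩
  g α + g β + sum (R f)  ≡⟨ cong (g α + g β +_) (sum-cong-≗ (λ j → rest _ (punchInᵢ≢i α _) (outside j))) ⟩
  g α + g β + sum (R g)  ≡⟨ split g ⟨
  sum g                  ∎
  where
  open ≤-Reasoning
  β′ = punchOut α≢β
  R : (Fin (suc (suc n)) → ℕ) → Fin n → ℕ
  R h = removeAt (removeAt h α) β′
  outside : ∀ j → punchIn α (punchIn β′ j) ≢ β
  outside j eq = punchInᵢ≢i β′ j (punchIn-injective α _ _ (trans eq (sym (punchIn-punchOut α≢β))))
  split : ∀ h → sum h ≡ h α + h β + sum (R h)
  split h = begin-equality
    sum h                                 ≡⟨ sum-remove {i = α} h ⟩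
    h α + sum (removeAt h α)              ≡⟨ cong (h α +_) (sum-remove {i = β′} (removeAt h α)) ⟩
    h α + (h (punchIn α β′) + sum (R h))  ≡⟨ cong (λ b → h α + (h b + sum (R h))) (punchIn-punchOut α≢β) ⟩
    h α + (h β + sum (R h))               ≡⟨ +-assoc (h α) (h β) (sum (R h)) ⟨
    h α + h β + sum (R h)                 ∎

sum-≗-except : ∀ {n} {f g : Fin n → ℕ} p → (∀ i → i ≢ p → f i ≡ g i) → g p + sum f ≡ f p + sum g
sum-≗-except {suc n} {f} {g} p f≡g = begin
  g p + sum f                       ≡⟨ cong (g p +_) (sum-remove {i = p} f) ⟩
  g p + (f p + sum (removeAt f p))  ≡⟨ x∙yz≈y∙xz (g p) (f p) _ ⟩
  f p + (g p + sum (removeAt f p))  ≡⟨ cong (λ r → f p + (g p + r)) (sum-cong-≗ (λ j → f≡g _ (punchInᵢ≢i p j))) ⟩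
  f p + (g p + sum (removeAt g p))  ≡⟨ cong (f p +_) (sum-remove {i = p} g) ⟨
  f p + sum g                       ∎
  where open ≡-Reasoning

count : ∀ {n p} {P : Pred (Fin n) p} → Decidable P → ℕ
count P? = sum (λ i → 𝟙 (P? i))

module _ {n p} {P : Pred (Fin n) p} (P? : Decidable P) where

  count-< : ∀ j → ¬ P j → count P? < n
  count-< j ¬Pj = subst (count P? <_) (sum-ones n)
    (sum-mono-< (λ i → 𝟙-≤1 (P? i)) j (subst (_< 1) (sym (𝟙-no (P? j) ¬Pj)) (s≤s z≤n)))
    where
    𝟙-≤1 : ∀ {a} {A : Set a} (d : Dec A) → 𝟙 d ≤ 1
    𝟙-≤1 (yes _) = ≤-refl
    𝟙-≤1 (no _)  = z≤n

  count-none : (∀ i → ¬ P i) → count P? ≡ 0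
  count-none ¬P = trans (sum-cong-≗ (λ i → 𝟙-no (P? i) (¬P i))) (sum-replicate-zero n)

  module _ {q} {Q : Pred (Fin n) q} (Q? : Decidable Q) where

    count-mono : P ⊆ Q → count P? ≤ count Q?
    count-mono P⊆Q = sum-mono (λ i → 𝟙-mono P⊆Q (P? i) (Q? i))

    count-mono-< : P ⊆ Q → ∀ j → Q j → ¬ P j → count P? < count Q?
    count-mono-< P⊆Q j Qj ¬Pj = sum-mono-< (λ i → 𝟙-mono P⊆Q (P? i) (Q? i)) j
      (subst₂ _<_ (sym (𝟙-no (P? j) ¬Pj)) (sym (𝟙-yes (Q? j) Qj)) (s≤s z≤n))

count-≟ : ∀ {n} (a : Fin n) → count (a ≟_) ≡ 1
count-≟ {n} a = trans (sum-cong-≗ {n} (λ j → sym (*-identityʳ _))) (sum-sift a (λ _ → 1))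

count≥2 : ∀ {n p} {P : Pred (Fin n) p} (P? : Decidable P) {u u′} → u ≢ u′ → P u → P u′ → 2 ≤ count P?
count≥2 P? {u} {u′} u≢u′ Pu Pu′ = subst (_< count P?) (count-≟ u)
  (count-mono-< (u ≟_) P? (λ { refl → Pu }) u′ Pu′ u≢u′)

sum-fibres : ∀ {k t} (f : Fin k → Fin t) (g : Fin t → ℕ) → sum (g ∘ f) ≡ sum (λ z → g z * count (λ u → f u ≟ z))
sum-fibres {k} {t} f g = sym (begin
  sum (λ z → g z * count (λ u → f u ≟ z))             ≡⟨ sum-cong-≗ {t} (λ z → *-distribˡ-sum (g z) (λ u → 𝟙 (f u ≟ z))) ⟩
  sum (λ z → sum (λ u → g z * 𝟙 (f u ≟ z)))           ≡⟨ ∑-comm (λ z u → g z * 𝟙 (f u ≟ z)) ⟩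
  sum (λ u → sum (λ z → g z * 𝟙 (f u ≟ z)))           ≡⟨ sum-cong-≗ {k} (λ u → trans (sum-cong-≗ {t} (λ z → *-comm (g z) _)) (sum-sift (f u) g)) ⟩
  sum (g ∘ f)                                         ∎)
  where open ≡-Reasoning

count-≤-insert : ∀ {n p q} {P : Pred (Fin n) p} {Q : Pred (Fin n) q} (P? : Decidable P) (Q? : Decidable Q) a →
                 (∀ {i} → P i → Q i ⊎ a ≡ i) → count P? ≤ suc (count Q?)
count-≤-insert {n} P? Q? a P⊆Q∪a = begin
  count P?                                ≤⟨ sum-mono pointwise ⟩
  sum (λ i → 𝟙 (Q? i) + 𝟙 (a ≟ i))      ≡⟨ ∑-distrib-+ (λ i → 𝟙 (Q? i)) (λ i → 𝟙 (a ≟ i)) ⟩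
  count Q? + count (a ≟_)                 ≡⟨ cong (count Q? +_) (count-≟ a) ⟩
  count Q? + 1                            ≡⟨ +-comm (count Q?) 1 ⟩
  suc (count Q?)                          ∎
  where
  open ≤-Reasoning
  pointwise : ∀ i → 𝟙 (P? i) ≤ 𝟙 (Q? i) + 𝟙 (a ≟ i)
  pointwise i with P? i
  ... | no _ = z≤n
  ... | yes Pi with P⊆Q∪a Pi
  ...   | inj₁ Qi   = m≤n⇒m≤n+o _ (≤-reflexive (sym (𝟙-yes (Q? i) Qi)))
  ...   | inj₂ refl = m≤n⇒m≤o+n _ (≤-reflexive (sym (𝟙-yes (a ≟ a) refl)))

injective⇒surjective : ∀ {n} {f : Fin n → Fin n} → Injective _≡_ _≡_ f → StrictlySurjective _≡_ f
injective⇒surjective {suc n} {f} f-injective y with any? (λ x → f x ≟ y)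
... | yes hit = hit
... | no miss = ⊥-elim (no-collision (pigeonhole (n<1+n n) squeezed))
  where
  avoid : ∀ x → y ≢ f x
  avoid x y≡fx = miss (x , sym y≡fx)
  squeezed : Fin (suc n) → Fin n
  squeezed x = punchOut (avoid x)
  no-collision : ¬ ∃₂ λ i j → toℕ i < toℕ j × squeezed i ≡ squeezed j
  no-collision (i , j , i<j , eq) = <⇒≢ i<j (cong toℕ (f-injective (punchOut-injective (avoid i) (avoid j) eq)))

module InverseOf {n} {f : Fin n → Fin n} (f-injective : Injective _≡_ _≡_ f) where

  f⁻¹ : Fin n → Fin n
  f⁻¹ y = proj₁ (injective⇒surjective f-injective y)

  f∘f⁻¹ : StrictlyInverseˡ _≡_ f f⁻¹
  f∘f⁻¹ y = proj₂ (injective⇒surjective f-injective y)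

  f⁻¹∘f : StrictlyInverseʳ _≡_ f f⁻¹
  f⁻¹∘f x = f-injective (f∘f⁻¹ (f x))

  f⁻¹-injective : Injective _≡_ _≡_ f⁻¹
  f⁻¹-injective {y} {y′} eq = trans (sym (f∘f⁻¹ y)) (trans (cong f eq) (f∘f⁻¹ y′))

InSitu : ∀ {s n} → List (Fin n) → (Point s n → Point s n) → Set
InSitu []      f = f ≗ id
InSitu (i ∷ σ) f = Σ[ ψ ∈ (Point _ _ → Fin _) ] Σ[ g ∈ (Point _ _ → Point _ _) ]
                     InSitu σ g × f ≗ g ∘ step (ψ , i)

module _ {s n : ℕ} where

  InSitu⇒program : ∀ {σ} {f : Point s n → Point s n} → InSitu σ f →
                   Σ[ p ∈ Program s n ] map proj₂ p ≡ σ × run p ≗ f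
  InSitu⇒program {[]}    f≗id = [] , refl , sym ∘ f≗id
  InSitu⇒program {i ∷ σ} (ψ , g , g-in-situ , f≗) =
    let p , p-sig , p-run = InSitu⇒program g-in-situ
    in  (ψ , i) ∷ p , cong (i ∷_) p-sig , λ X → trans (p-run _) (sym (f≗ X))

  InSitu-resp : ∀ {σ} {f f′ : Point s n → Point s n} → f ≗ f′ → InSitu σ f → InSitu σ f′
  InSitu-resp {[]}    f≗f′ f≗id                     = λ X → trans (sym (f≗f′ X)) (f≗id X)
  InSitu-resp {i ∷ σ} f≗f′ (ψ , g , g-in-situ , f≗) = ψ , g , g-in-situ , λ X → trans (sym (f≗f′ X)) (f≗ X)

  InSitu-∘ : ∀ {σ τ} {f g : Point s n → Point s n} → InSitu σ f → InSitu τ g → InSitu (σ ++ τ) (g ∘ f)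
  InSitu-∘ {[]}    {g = g} f≗id                     g-in-situ = InSitu-resp (λ X → cong g (sym (f≗id X))) g-in-situ
  InSitu-∘ {i ∷ σ} {g = g} (ψ , h , h-in-situ , f≗) g-in-situ =
    ψ , g ∘ h , InSitu-∘ h-in-situ g-in-situ , cong g ∘ f≗

  InSitu-merge : ∀ {σ τ i} {f g : Point s n → Point s n} →
                 InSitu (σ ∷ʳ i) f → InSitu (i ∷ τ) g → InSitu (σ ++ i ∷ τ) (g ∘ f)
  InSitu-merge {[]} {i = i} {f} {g} (ψ , h , h≗id , f≗) (φ , k , k-in-situ , g≗) =
    φ ∘ step (ψ , i) , k , k-in-situ , λ X → begin
      g (f X)                            ≡⟨ cong g (trans (f≗ X) (h≗id _)) ⟩
      g (step (ψ , i) X)                 ≡⟨ g≗ _ ⟩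
      k (step (φ , i) (step (ψ , i) X))  ≡⟨ cong k ([]≔-idempotent X i) ⟩
      k (step (φ ∘ step (ψ , i) , i) X)  ∎
    where open ≡-Reasoning
  InSitu-merge {j ∷ σ} {g = g} (ψ , h , h-in-situ , f≗) g-in-situ =
    ψ , g ∘ h , InSitu-merge h-in-situ g-in-situ , cong g ∘ f≗

InSitu-head : ∀ {s m} (φ : Point s (suc m) → Fin s) → InSitu (zero ∷ []) (λ X → φ X ∷ tail X)
InSitu-head φ = φ , id , (λ _ → refl) , λ { (x ∷ u) → refl }

InSitu-lift : ∀ {s m} {σ : List (Fin m)} (F : Fin s → Point s m → Point s m) → (∀ c → InSitu σ (F c)) →
              InSitu (map suc σ) (λ X → head X ∷ F (head X) (tail X))
InSitu-lift {σ = []}    F F-in-situ (x ∷ u) = cong (x ∷_) (F-in-situ x u)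
InSitu-lift {σ = i ∷ σ} F F-in-situ =
  (λ X → ψ (head X) (tail X)) ,
  (λ X → head X ∷ G (head X) (tail X)) ,
  InSitu-lift G (λ c → proj₁ (proj₂ (proj₂ (F-in-situ c)))) ,
  λ { (x ∷ u) → cong (x ∷_) (proj₂ (proj₂ (proj₂ (F-in-situ x))) u) }
  where
  ψ = λ c → proj₁ (F-in-situ c)
  G = λ c → proj₁ (proj₂ (F-in-situ c))

InSitu-void : ∀ {m} (σ : List (Fin (suc m))) (f : Point 0 (suc m) → Point 0 (suc m)) → InSitu σ f
InSitu-void []      f (() ∷ _)
InSitu-void (i ∷ σ) f = (λ { (() ∷ _) }) , f , InSitu-void σ f , λ { (() ∷ _) }

mirror : ∀ {s n} → Point s n → Point s n
mirror X = Vec.tabulate (lookup X ∘ opposite)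

module _ {s n : ℕ} where

  mirror-involutive : (X : Point s n) → mirror (mirror X) ≡ X
  mirror-involutive X = trans (tabulate-cong λ j →
    trans (lookup∘tabulate _ (opposite j)) (cong (lookup X) (opposite-involutive j))) (tabulate∘lookup X)

  mirror-update : ∀ (X : Point s n) i a → mirror (X [ i ]≔ a) ≡ mirror X [ opposite i ]≔ a
  mirror-update X i a = trans (tabulate-cong entry) (tabulate∘lookup _)
    where
    entry : ∀ j → lookup (X [ i ]≔ a) (opposite j) ≡ lookup (mirror X [ opposite i ]≔ a) j
    entry j with opposite j ≟ i
    ... | yes refl = begin
      lookup (X [ opposite j ]≔ a) (opposite j)          ≡⟨ lookup∘update (opposite j) X a ⟩
      a                                                  ≡⟨ lookup∘update j (mirror X) a ⟨
      lookup (mirror X [ j ]≔ a) j                       ≡⟨ cong (λ k → lookup (mirror X [ k ]≔ a) j) (opposite-involutive j) ⟨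
      lookup (mirror X [ opposite (opposite j) ]≔ a) j   ∎
      where open ≡-Reasoning
    ... | no oj≢i = begin
      lookup (X [ i ]≔ a) (opposite j)             ≡⟨ lookup∘update′ oj≢i X a ⟩
      lookup X (opposite j)                        ≡⟨ lookup∘tabulate _ j ⟨
      lookup (mirror X) j                          ≡⟨ lookup∘update′ j≢oi (mirror X) a ⟨
      lookup (mirror X [ opposite i ]≔ a) j        ∎
      where
      open ≡-Reasoning
      j≢oi : j ≢ opposite i
      j≢oi refl = oj≢i (opposite-involutive i)

  InSitu-mirror : ∀ {σ} {f : Point s n → Point s n} → InSitu σ f → InSitu (map opposite σ) (mirror ∘ f ∘ mirror)
  InSitu-mirror {[]}    f≗id Y = trans (cong mirror (f≗id (mirror Y))) (mirror-involutive Y)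
  InSitu-mirror {i ∷ σ} (ψ , g , g-in-situ , f≗) =
    ψ ∘ mirror , mirror ∘ g ∘ mirror , InSitu-mirror g-in-situ , λ Y → cong mirror (trans (f≗ (mirror Y)) (cong g (begin
      step (ψ , i) (mirror Y)                                   ≡⟨ mirror-involutive _ ⟨
      mirror (mirror (mirror Y [ i ]≔ ψ (mirror Y)))            ≡⟨ cong mirror (mirror-update (mirror Y) i _) ⟩
      mirror (mirror (mirror Y) [ opposite i ]≔ ψ (mirror Y))   ≡⟨ cong (λ Z → mirror (Z [ opposite i ]≔ ψ (mirror Y))) (mirror-involutive Y) ⟩
      mirror (step (ψ ∘ mirror , opposite i) Y)                 ∎)))
    where open ≡-Reasoning

-- Points as base-s numerals

module _ (s : ℕ) .{{_ : NonZero s}} where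

  /-between : ∀ {q y} → q * s ≤ y → y < suc q * s → y / s ≡ q
  /-between {q} q*s≤y y<[1+q]*s =
    ≤-antisym (s≤s⁻¹ (m<n*o⇒m/o<n y<[1+q]*s)) (subst (_≤ _) (m*n/n≡m q s) (/-monoˡ-≤ s q*s≤y))

  [r+q*s]/s≡q : ∀ {r} q → r < s → (r + q * s) / s ≡ q
  [r+q*s]/s≡q q r<s = /-between (m≤n+m (q * s) _) (+-monoˡ-< (q * s) r<s)

  [a+s]/s≡1+a/s : ∀ a → (a + s) / s ≡ suc (a / s)
  [a+s]/s≡1+a/s a = trans (m/n≡1+[m∸n]/n (m≤n+m s a)) (cong (λ b → suc (b / s)) (m+n∸n≡m a s))

  [r+q*s]%s≡r : ∀ {r} q → r < s → (r + q * s) % s ≡ r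
  [r+q*s]%s≡r {r} q r<s = trans ([m+kn]%n≡m%n r q s) (m<n⇒m%n≡m r<s)

module _ {s : ℕ} where

  index : ∀ {n} → Point s n → ℕ
  index []      = 0
  index (x ∷ X) = toℕ x + index X * s

  index< : ∀ {n} (X : Point s n) → index X < s ^ n
  index< []            = s≤s z≤n
  index< {suc n} (x ∷ X) = begin-strict
    toℕ x + index X * s   <⟨ +-monoˡ-< (index X * s) (toℕ<n x) ⟩
    suc (index X) * s     ≤⟨ *-monoˡ-≤ s (index< X) ⟩
    s ^ n * s             ≡⟨ *-comm (s ^ n) s ⟩
    s ^ suc n             ∎
    where open ≤-Reasoning

  module _ .{{_ : NonZero s}} where

    fromIndex : ∀ n → ℕ → Point s n
    fromIndex zero    _ = []
    fromIndex (suc n) j = fromℕ< (m%n<n j s) ∷ fromIndex n (j / s)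

    fromIndex-index : ∀ {n} (X : Point s n) → fromIndex n (index X) ≡ X
    fromIndex-index []      = refl
    fromIndex-index (x ∷ X) = cong₂ _∷_
      (toℕ-injective (trans (toℕ-fromℕ< _) ([r+q*s]%s≡r s (index X) (toℕ<n x))))
      (trans (cong (fromIndex _) ([r+q*s]/s≡q s (index X) (toℕ<n x))) (fromIndex-index X))

    index-fromIndex : ∀ n {j} → j < s ^ n → index (fromIndex n j) ≡ j
    index-fromIndex zero    {zero}  _         = refl
    index-fromIndex zero    {suc j} (s≤s ())
    index-fromIndex (suc n) {j}    j<s^[1+n] = begin
      toℕ (fromℕ< (m%n<n j s)) + index (fromIndex n (j / s)) * s ≡⟨ cong₂ _+_ (toℕ-fromℕ< _) (cong (_* s) (index-fromIndex n j/s<s^n)) ⟩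
      j % s + j / s * s                                         ≡⟨ m≡m%n+[m/n]*n j s ⟨
      j                                                         ∎
      where
      open ≡-Reasoning
      j/s<s^n = m<n*o⇒m/o<n (subst (j <_) (*-comm s (s ^ n)) j<s^[1+n])

module Encoding {s} .{{_ : NonZero s}} (n : ℕ) where

  encode : Point s n → Fin (s ^ n)
  encode X = fromℕ< (index< X)

  decode : Fin (s ^ n) → Point s n
  decode k = fromIndex n (toℕ k)

  decode-encode : ∀ X → decode (encode X) ≡ X
  decode-encode X = trans (cong (fromIndex n) (toℕ-fromℕ< (index< X))) (fromIndex-index X)

  index-decode : ∀ k → index (decode k) ≡ toℕ k
  index-decode k = index-fromIndex n (toℕ<n k)

  encode-decode : ∀ k → encode (decode k) ≡ k
  encode-decode k = toℕ-injective (trans (toℕ-fromℕ< _) (index-decode k))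

  encode-injective : Injective _≡_ _≡_ encode
  encode-injective {X} {Y} eq = trans (sym (decode-encode X)) (trans (cong decode eq) (decode-encode Y))

  decode-injective : Injective _≡_ _≡_ decode
  decode-injective {k} {k′} eq = trans (sym (encode-decode k)) (trans (cong encode eq) (encode-decode k′))

-- König's edge-colouring theorem

Unique-length≤ : ∀ {k} (us : List (Fin k)) → Unique us → length us ≤ k
Unique-length≤ {k} us unique with length us ≤? k
... | yes ≤k = ≤k
... | no  ≰k = ⊥-elim (no-repeat (pigeonhole (≰⇒> ≰k) (List.lookup us)))
  where
  lookup-injective : ∀ {vs : List (Fin k)} → Unique vs → ∀ i j → List.lookup vs i ≡ List.lookup vs j → i ≡ j
  lookup-injective (_  ∷ _)   zero    zero    _  = refl
  lookup-injective (v∉ ∷ _)   zero    (suc j) eq = contradiction eq (All.lookup v∉ (∈-lookup j))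
  lookup-injective (v∉ ∷ _)   (suc i) zero    eq = contradiction (sym eq) (All.lookup v∉ (∈-lookup i))
  lookup-injective (_  ∷ vs!) (suc i) (suc j) eq = cong suc (lookup-injective vs! i j eq)
  no-repeat : ¬ ∃₂ λ i j → toℕ i < toℕ j × List.lookup us i ≡ List.lookup us j
  no-repeat (i , j , i<j , eq) = <⇒≢ i<j (cong toℕ (lookup-injective unique i j eq))

Unique-++⁻ʳ : ∀ {A : Set} (xs : List A) {ys} → Unique (xs ++ ys) → Unique ys
Unique-++⁻ʳ []       unique       = unique
Unique-++⁻ʳ (x ∷ xs) (_ ∷ unique) = Unique-++⁻ʳ xs unique

module Reachability {k t : ℕ} (src tgt : Fin k → Fin t) where

  open import Data.List.Membership.DecPropositional {A = Fin k} _≟_ using (_∈?_)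

  -- The edges of a walk are listed from its last edge backwards.
  Walk : Fin t → List (Fin k) → Fin t → Set
  Walk x []       z = x ≡ z
  Walk x (u ∷ us) z = tgt u ≡ z × Walk x us (src u)

  walk-++⁻ : ∀ {x z} us {vs} → Walk x (us ++ vs) z → ∃[ y ] Walk y us z × Walk x vs y
  walk-++⁻ []       walk          = _ , refl , walk
  walk-++⁻ (u ∷ us) (tu≡z , walk) = let y , walk₁ , walk₂ = walk-++⁻ us walk in y , (tu≡z , walk₁) , walk₂

  walk-unique : ∀ {x z} us → Walk x us z → ∃[ vs ] Unique vs × Walk x vs z
  walk-unique []       walk          = [] , [] , walk
  walk-unique (u ∷ us) (tu≡z , walk) with walk-unique us walk
  ... | vs , unique , walk′ with u ∈? vs
  ...   | no  u∉vs = u ∷ vs , ¬Any⇒All¬ vs u∉vs ∷ unique , tu≡z , walk′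
  ...   | yes u∈vs with ∈-∃++ u∈vs
  ...     | ys , zs , refl = u ∷ zs , Unique-++⁻ʳ ys unique , tu≡z , proj₂ (proj₂ (proj₂ (walk-++⁻ ys walk′)))

  module _ (x : Fin t) where

    Reachable : ℕ → Fin t → Set
    Reachable i z = ∃[ us ] length us ≤ i × Walk x us z

    reachable? : ∀ i → Decidable (Reachable i)
    reachable? zero    z = map′ (λ x≡z → [] , z≤n , x≡z) (λ { ([] , _ , x≡z) → x≡z }) (x ≟ z)
    reachable? (suc i) z = map′ extend last-edge ((x ≟ z) ⊎-dec any? (λ u → (tgt u ≟ z) ×-dec reachable? i (src u)))
      where
      extend : x ≡ z ⊎ (∃[ u ] tgt u ≡ z × Reachable i (src u)) → Reachable (suc i) z
      extend (inj₁ x≡z)                              = [] , z≤n , x≡z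
      extend (inj₂ (u , tu≡z , us , |us|≤i , walk)) = u ∷ us , s≤s |us|≤i , tu≡z , walk
      last-edge : Reachable (suc i) z → x ≡ z ⊎ (∃[ u ] tgt u ≡ z × Reachable i (src u))
      last-edge ([]     , _           , x≡z)         = inj₁ x≡z
      last-edge (u ∷ us , s≤s |us|≤i , tu≡z , walk) = inj₂ (u , tu≡z , us , |us|≤i , walk)

    -- Unique walks have length at most k, so `Reachable k` is closed under edges.
    reachable-closed : ∀ u → Reachable k (src u) → Reachable k (tgt u)
    reachable-closed u (us , _ , walk) =
      let vs , unique , walk′ = walk-unique (u ∷ us) (refl , walk) in vs , Unique-length≤ vs unique , walk′

    reach : ∀ {p} {P : Pred (Fin t) p} → Decidable P →
            (∃[ z ] ∃[ us ] Unique us × Walk x us z × P z) ⊎ (∀ z → Reachable k z → ¬ P z)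
    reach P? with any? (λ z → reachable? k z ×-dec P? z)
    ... | yes (z , (us , _ , walk) , Pz) = let vs , unique , walk′ = walk-unique us walk in inj₁ (z , vs , unique , walk′ , Pz)
    ... | no  none                       = inj₂ (λ z reachable Pz → none (z , reachable , Pz))

count-closed : ∀ {k t} (src tgt : Fin k → Fin t) {r} {R : Pred (Fin t) r} (R? : Decidable R) →
               (∀ u → R (src u) → R (tgt u)) → (∀ z → R z → count (λ u → tgt u ≟ z) ≤ count (λ u → src u ≟ z)) →
               ∀ x → R x → ¬ count (λ u → tgt u ≟ x) < count (λ u → src u ≟ x)
count-closed src tgt R? closed ≤-in-R x Rx <-at-x = <⇒≱ heads<tails tails≤heads
  where
  tails≤heads : sum (λ u → 𝟙 (R? (src u))) ≤ sum (λ u → 𝟙 (R? (tgt u)))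
  tails≤heads = sum-mono (λ u → 𝟙-mono (closed u) (R? (src u)) (R? (tgt u)))
  weighted : ∀ z → 𝟙 (R? z) * count (λ u → tgt u ≟ z) ≤ 𝟙 (R? z) * count (λ u → src u ≟ z)
  weighted z with R? z
  ... | yes Rz = *-monoʳ-≤ 1 (≤-in-R z Rz)
  ... | no  _  = z≤n
  heads<tails : sum (λ u → 𝟙 (R? (tgt u))) < sum (λ u → 𝟙 (R? (src u)))
  heads<tails = subst₂ _<_ (sym (sum-fibres tgt (𝟙 ∘ R?))) (sym (sum-fibres src (𝟙 ∘ R?)))
    (sum-mono-< weighted x (subst (λ b → b * _ < b * _) (sym (𝟙-yes (R? x) Rx)) (*-monoʳ-< 1 <-at-x)))

cancel-chain : ∀ {a b c e f g} → b + e ≡ a + f → c + f ≡ b + g → c + e ≡ a + g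
cancel-chain {a} {b} {c} {e} {f} {g} h₁ h₂ = +-cancelˡ-≡ b _ _ (begin
  b + (c + e)   ≡⟨ x∙yz≈y∙xz b c e ⟩
  c + (b + e)   ≡⟨ cong (c +_) h₁ ⟩
  c + (a + f)   ≡⟨ x∙yz≈y∙xz c a f ⟩
  a + (c + f)   ≡⟨ cong (a +_) h₂ ⟩
  a + (b + g)   ≡⟨ x∙yz≈y∙xz a b g ⟩
  b + (a + g)   ∎)
  where open ≡-Reasoning

-- The excesses d ∸ 1 of colours α and β at the first and at the last vertex of a Kempe chain.
∸1-start : ∀ {a a′ b b′} → suc a′ ≡ a → b′ ≡ suc b → 2 ≤ a → b ≡ 0 → a′ ∸ 1 + (b′ ∸ 1) < a ∸ 1 + (b ∸ 1)
∸1-start {suc (suc a″)} refl refl _        refl = +-monoˡ-< 0 (n<1+n a″)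
∸1-start {suc zero}     refl refl (s≤s ()) refl

∸1-end : ∀ {a a′ b b′} → a′ ≡ suc a → suc b′ ≡ b → a < b → a′ ∸ 1 + (b′ ∸ 1) ≤ a ∸ 1 + (b ∸ 1)
∸1-end {zero}                refl refl _        = m∸n≤m _ 1
∸1-end {suc a} {b′ = suc b″} refl refl _        = ≤-reflexive (sym (+-suc a b″))
∸1-end {suc a} {b′ = zero}   refl refl (s≤s ())

module König {s t : ℕ} (π : Fin s × Fin t → Fin s × Fin t) (π-injective : Injective _≡_ _≡_ π) where

  -- The edge of colour c at the left vertex u is (σ u c , u); the edge (a , u) arrives at the
  -- right vertex proj₂ (π (a , u)).
  Colouring : Set
  Colouring = Fin t → Fin s → Fin s

  LeftProper : Colouring → Set
  LeftProper σ = ∀ u → Injective _≡_ _≡_ (σ u)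

  target : Colouring → Fin s → Fin t → Fin t
  target σ c u = proj₂ (π (σ u c , u))

  Proper : Colouring → Set
  Proper σ = ∀ c → Injective _≡_ _≡_ (target σ c)

  degree : Colouring → Fin s → Fin t → ℕ
  degree σ c w = count (λ u → target σ c u ≟ w)

  excess : Colouring → ℕ
  excess σ = sum (λ c → sum (λ w → degree σ c w ∸ 1))

  arrivals≤s : ∀ {σ} → LeftProper σ → ∀ {n w} (e : Fin n → Fin t × Fin s) → Injective _≡_ _≡_ e →
               (∀ i → target σ (proj₂ (e i)) (proj₁ (e i)) ≡ w) → n ≤ s
  arrivals≤s {σ} σ-lp {n} e e-injective arrives with n ≤? s
  ... | yes n≤s = n≤s
  ... | no  n≰s = ⊥-elim (no-collision (pigeonhole (≰⇒> n≰s) (proj₁ ∘ π ∘ edge ∘ e)))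
    where
    edge : Fin t × Fin s → Fin s × Fin t
    edge (u , c) = σ u c , u
    edge-injective : Injective _≡_ _≡_ edge
    edge-injective {u , c} {u′ , c′} eq with ,-injective eq
    ... | σuc≡σuc′ , refl = cong (u ,_) (σ-lp u σuc≡σuc′)
    no-collision : ¬ ∃₂ λ i j → toℕ i < toℕ j × proj₁ (π (edge (e i))) ≡ proj₁ (π (edge (e j)))
    no-collision (i , j , i<j , eq) = <⇒≢ i<j (cong toℕ (e-injective (edge-injective (π-injective
      (×-≡,≡→≡ (eq , trans (arrives i) (sym (arrives j))))))))

  missing-colour : ∀ {σ} → LeftProper σ → ∀ {α u u′} → u ≢ u′ → target σ α u ≡ target σ α u′ →
                   ∃[ β ] ∀ v → target σ β v ≢ target σ α u
  missing-colour {σ} σ-lp {α} {u} {u′} u≢u′ eq with all? (λ β → any? (λ v → target σ β v ≟ target σ α u))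
  ... | no  ¬all-arrive = let β , β-missing = ¬∀⟶∃¬ s _ (λ β → any? (λ v → target σ β v ≟ target σ α u)) ¬all-arrive
                          in  β , λ v arrives → β-missing (v , arrives)
  ... | yes all-arrive = ⊥-elim (1+n≰n (arrivals≤s σ-lp e e-injective arrives))
    where
    -- The second α-edge and one edge of each colour are s + 1 edges arriving at one vertex.
    v : Fin s → Fin t
    v β = proj₁ (all-arrive β)
    second : ∃[ u* ] u* ≢ v α × target σ α u* ≡ target σ α u
    second with u ≟ v α
    ... | yes u≡vα = u′ , (λ u′≡vα → u≢u′ (trans u≡vα (sym u′≡vα))) , sym eq
    ... | no  u≢vα = u , u≢vα , refl
    e : Fin (suc s) → Fin t × Fin s
    e zero    = proj₁ second , α
    e (suc β) = v β , β
    e-injective : Injective _≡_ _≡_ e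
    e-injective {zero}  {zero}   _  = refl
    e-injective {zero}  {suc β}  eq = contradiction (trans (cong proj₁ eq) (cong v (sym (cong proj₂ eq)))) (proj₁ (proj₂ second))
    e-injective {suc β} {zero}   eq = contradiction (trans (cong proj₁ (sym eq)) (cong v (cong proj₂ eq))) (proj₁ (proj₂ second))
    e-injective {suc β} {suc β′} eq = cong suc (cong proj₂ eq)
    arrives : ∀ i → target σ (proj₂ (e i)) (proj₁ (e i)) ≡ target σ α u
    arrives zero    = proj₂ (proj₂ second)
    arrives (suc β) = proj₂ (all-arrive β)

  module Kempe {α β : Fin s} (α≢β : α ≢ β) where

    module Alternating (σ : Colouring) = Reachability (target σ α) (target σ β)
    open Alternating using (Walk)

    τ : Fin s → Fin s
    τ = transpose α β

    τ-α : τ α ≡ β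
    τ-α rewrite dec-true (α ≟ α) refl = refl

    τ-β : τ β ≡ α
    τ-β rewrite dec-false (β ≟ α) (α≢β ∘ sym) | dec-true (β ≟ β) refl = refl

    τ-other : ∀ {c} → c ≢ α → c ≢ β → τ c ≡ c
    τ-other {c} c≢α c≢β rewrite dec-false (c ≟ α) c≢α | dec-false (c ≟ β) c≢β = refl

    τ-injective : Injective _≡_ _≡_ τ
    τ-injective {c} {c′} eq = trans (sym (transpose-inverse β α)) (trans (cong (transpose β α) eq) (transpose-inverse β α))

    swapped : ∀ {u u₀ : Fin t} → Dec (u ≡ u₀) → (Fin s → Fin s) → Fin s → Fin s
    swapped (yes _) f = f ∘ τ
    swapped (no _)  f = f

    swap : Colouring → Fin t → Colouring
    swap σ u₀ u = swapped (u ≟ u₀) (σ u)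

    swap-leftProper : ∀ {σ} u₀ → LeftProper σ → LeftProper (swap σ u₀)
    swap-leftProper u₀ σ-lp u with u ≟ u₀
    ... | yes _ = τ-injective ∘ σ-lp u
    ... | no  _ = σ-lp u

    target-swap-≢ : ∀ σ {u₀ u} → u ≢ u₀ → ∀ c → target (swap σ u₀) c u ≡ target σ c u
    target-swap-≢ σ {u₀} {u} u≢u₀ c with u ≟ u₀
    ... | yes u≡u₀ = contradiction u≡u₀ u≢u₀
    ... | no  _    = refl

    target-swap-≡ : ∀ σ u c → target (swap σ u) c u ≡ target σ (τ c) u
    target-swap-≡ σ u c with u ≟ u
    ... | yes _   = refl
    ... | no  u≢u = contradiction refl u≢u

    degree-swap : ∀ σ u c w → 𝟙 (target σ c u ≟ w) + degree (swap σ u) c w ≡ 𝟙 (target σ (τ c) u ≟ w) + degree σ c w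
    degree-swap σ u c w = trans
      (sum-≗-except u (λ v v≢u → cong (λ a → 𝟙 (a ≟ w)) (target-swap-≢ σ v≢u c)))
      (cong (λ a → 𝟙 (a ≟ w) + degree σ c w) (target-swap-≡ σ u c))

    -- σ′ arises from σ by moving one α-arrival from x to z and one β-arrival from z to x.
    Shifted : Colouring → Colouring → Fin t → Fin t → Set
    Shifted σ′ σ x z =
      (∀ w → 𝟙 (x ≟ w) + degree σ′ α w ≡ 𝟙 (z ≟ w) + degree σ α w) ×
      (∀ w → 𝟙 (z ≟ w) + degree σ′ β w ≡ 𝟙 (x ≟ w) + degree σ β w) ×
      (∀ c → c ≢ α → c ≢ β → ∀ w → degree σ′ c w ≡ degree σ c w)

    shifted-refl : ∀ {σ x} → Shifted σ σ x x
    shifted-refl = (λ _ → refl) , (λ _ → refl) , (λ _ _ _ _ → refl)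

    shifted-trans : ∀ {σ″ σ′ σ x y z} → Shifted σ″ σ′ x y → Shifted σ′ σ y z → Shifted σ″ σ x z
    shifted-trans {x = x} {y} {z} (α₁ , β₁ , rest₁) (α₂ , β₂ , rest₂) =
      (λ w → trans (α₁ w) (α₂ w)) ,
      (λ w → cancel-chain {𝟙 (x ≟ w)} {𝟙 (y ≟ w)} {𝟙 (z ≟ w)} (β₁ w) (β₂ w)) ,
      (λ c c≢α c≢β w → trans (rest₁ c c≢α c≢β w) (rest₂ c c≢α c≢β w))

    swap-shifted : ∀ σ u → Shifted (swap σ u) σ (target σ α u) (target σ β u)
    swap-shifted σ u =
      (λ w → trans (degree-swap σ u α w) (cong (λ c → 𝟙 (target σ c u ≟ w) + degree σ α w) τ-α)) ,
      (λ w → trans (degree-swap σ u β w) (cong (λ c → 𝟙 (target σ c u ≟ w) + degree σ β w) τ-β)) ,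
      (λ c c≢α c≢β w → +-cancelˡ-≡ _ _ _ (trans (degree-swap σ u c w)
                         (cong (λ c′ → 𝟙 (target σ c′ u ≟ w) + degree σ c w) (τ-other c≢α c≢β))))

    walk-swap : ∀ σ {u₀ x y} vs → All (u₀ ≢_) vs → Walk σ x vs y → Walk (swap σ u₀) x vs y
    walk-swap σ []       []            walk          = walk
    walk-swap σ {u₀} {x} (v ∷ vs) (u₀≢v ∷ u₀∉vs) (tv≡y , walk) =
      trans (target-swap-≢ σ v≢u₀ β) tv≡y ,
      subst (Walk (swap σ u₀) x vs) (sym (target-swap-≢ σ v≢u₀ α)) (walk-swap σ vs u₀∉vs walk)
      where
      v≢u₀ : v ≢ u₀
      v≢u₀ = u₀≢v ∘ sym

    swapAll : Colouring → List (Fin t) → Colouring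
    swapAll σ []       = σ
    swapAll σ (u ∷ us) = swapAll (swap σ u) us

    swapAll-leftProper : ∀ {σ} us → LeftProper σ → LeftProper (swapAll σ us)
    swapAll-leftProper []       σ-lp = σ-lp
    swapAll-leftProper (u ∷ us) σ-lp = swapAll-leftProper us (swap-leftProper u σ-lp)

    swapAll-shifted : ∀ σ {x z} us → Unique us → Walk σ x us z → Shifted (swapAll σ us) σ x z
    swapAll-shifted σ {x} []       []               refl          = shifted-refl {σ} {x}
    swapAll-shifted σ {x} (u ∷ us) (u∉us ∷ unique) (tu≡z , walk) = subst (Shifted (swapAll σ (u ∷ us)) σ x) tu≡z
      (shifted-trans {x = x} {target σ α u} {target σ β u} (swapAll-shifted (swap σ u) us unique (walk-swap σ us u∉us walk)) (swap-shifted σ u))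

    excess-decreases : ∀ {σ′ σ x z} → Shifted σ′ σ x z → 2 ≤ degree σ α x → degree σ β x ≡ 0 →
                       degree σ α z < degree σ β z → excess σ′ < excess σ
    excess-decreases {σ′} {σ} {x} {z} (α-shift , β-shift , rest) 2≤dαx dβx≡0 dαz<dβz =
      sum-<-two-points α≢β (λ c c≢α c≢β → sum-cong-≗ (λ w → cong (_∸ 1) (rest c c≢α c≢β w)))
        (subst₂ _<_ (∑-distrib-+ (λ w → e σ′ α w) (λ w → e σ′ β w)) (∑-distrib-+ (λ w → e σ α w) (λ w → e σ β w))
                (sum-mono-< (λ w → at w (α-shift w) (β-shift w)) x (at-x (α-shift x) (β-shift x))))
      where
      e : Colouring → Fin s → Fin t → ℕ
      e ρ c w = degree ρ c w ∸ 1
      x≢z : x ≢ z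
      x≢z refl = <⇒≱ dαz<dβz (subst (_≤ degree σ α x) (sym dβx≡0) z≤n)
      at : ∀ w → 𝟙 (x ≟ w) + degree σ′ α w ≡ 𝟙 (z ≟ w) + degree σ α w →
                 𝟙 (z ≟ w) + degree σ′ β w ≡ 𝟙 (x ≟ w) + degree σ β w → e σ′ α w + e σ′ β w ≤ e σ α w + e σ β w
      at w A B with x ≟ w | z ≟ w
      ... | yes refl | yes refl = contradiction refl x≢z
      ... | yes refl | no  _    = <⇒≤ (∸1-start A B 2≤dαx dβx≡0)
      ... | no  _    | yes refl = ∸1-end A B dαz<dβz
      ... | no  _    | no  _    = ≤-reflexive (cong₂ (λ a b → a ∸ 1 + (b ∸ 1)) A B)
      at-x : 𝟙 (x ≟ x) + degree σ′ α x ≡ 𝟙 (z ≟ x) + degree σ α x →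
             𝟙 (z ≟ x) + degree σ′ β x ≡ 𝟙 (x ≟ x) + degree σ β x → e σ′ α x + e σ′ β x < e σ α x + e σ β x
      at-x A B with x ≟ x | z ≟ x
      ... | no  x≢x  | _        = contradiction refl x≢x
      ... | yes _    | yes refl = contradiction refl x≢z
      ... | yes _    | no  _    = ∸1-start A B 2≤dαx dβx≡0

    kempe-step : ∀ σ → LeftProper σ → ∀ {x} → 2 ≤ degree σ α x → degree σ β x ≡ 0 →
                 ∃[ σ′ ] LeftProper σ′ × excess σ′ < excess σ
    kempe-step σ σ-lp {x} 2≤dαx dβx≡0 with reach x (λ z → degree σ α z <? degree σ β z)
      where open Alternating σ
    ... | inj₁ (z , us , unique , walk , dαz<dβz) =
      swapAll σ us , swapAll-leftProper us σ-lp , excess-decreases (swapAll-shifted σ us unique walk) 2≤dαx dβx≡0 dαz<dβz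
    ... | inj₂ unreachable = ⊥-elim (count-closed (target σ α) (target σ β)
      (Alternating.reachable? σ x t) (Alternating.reachable-closed σ x)
      (λ z reachable → ≮⇒≥ (unreachable z reachable)) x ([] , z≤n , refl) (subst (_< degree σ α x) (sym dβx≡0) (≤-trans (s≤s z≤n) 2≤dαx)))

  improve : ∀ σ → LeftProper σ → Proper σ ⊎ ∃[ σ′ ] LeftProper σ′ × excess σ′ < excess σ
  improve σ σ-lp with any? (λ α → any? (λ u → any? (λ u′ → (target σ α u ≟ target σ α u′) ×-dec ¬? (u ≟ u′))))
  ... | no  none = inj₁ λ α {u} {u′} eq → decidable-stable (u ≟ u′) (λ u≢u′ → none (α , u , u′ , eq , u≢u′))
  ... | yes (α , u , u′ , eq , u≢u′) = inj₂ (Kempe.kempe-step α≢β σ σ-lp 2≤dαx dβx≡0)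
    where
    β = proj₁ (missing-colour σ-lp u≢u′ eq)
    2≤dαx : 2 ≤ degree σ α (target σ α u)
    2≤dαx = count≥2 (λ v → target σ α v ≟ target σ α u) u≢u′ refl (sym eq)
    dβx≡0 : degree σ β (target σ α u) ≡ 0
    dβx≡0 = count-none (λ v → target σ β v ≟ target σ α u) (proj₂ (missing-colour σ-lp u≢u′ eq))
    α≢β : α ≢ β
    α≢β α≡β = <⇒≱ (≤-trans (s≤s z≤n) 2≤dαx) (≤-reflexive (trans (cong (λ c → degree σ c _) α≡β) dβx≡0))

  proper-colouring : ∀ σ → LeftProper σ → Acc _<_ (excess σ) → ∃[ σ′ ] LeftProper σ′ × Proper σ′
  proper-colouring σ σ-lp (acc smaller) with improve σ σ-lp
  ... | inj₁ σ-proper              = σ , σ-lp , σ-proper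
  ... | inj₂ (σ′ , σ′-lp , σ′<σ) = proper-colouring σ′ σ′-lp (smaller σ′<σ)

  könig : ∃[ σ ] LeftProper σ × Proper σ
  könig = proper-colouring (λ _ → id) (λ _ → id) (<-wellFounded _)

-- Beneš programs for bijections

benesSignature : ∀ m → List (Fin (suc m))
benesSignature zero    = zero ∷ []
benesSignature (suc m) = zero ∷ (map suc (benesSignature m) ∷ʳ zero)

head∷tail : ∀ {a} {A : Set a} {n} (Y : Vec A (suc n)) → head Y ∷ tail Y ≡ Y
head∷tail (y ∷ ys) = refl

-- König's theorem colours the edges x ∷ u ↦ π (x ∷ u) between tails so that each colour class
-- is a bijection of tails: the first assignment replaces the head by the colour, the middle
-- stage routes each colour class recursively, and the last assignment writes the head of π.
module BenesStep {s} .{{_ : NonZero s}} {m} (π : Point s (suc (suc m)) → Point s (suc (suc m)))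
                 (π-injective : Injective _≡_ _≡_ π) where

  open Encoding (suc m)

  private
    t = s ^ suc m

  π̂ : Fin s × Fin t → Fin s × Fin t
  π̂ (a , k) = head (π (a ∷ decode k)) , encode (tail (π (a ∷ decode k)))

  π̂-injective : Injective _≡_ _≡_ π̂
  π̂-injective {a , k} {a′ , k′} eq =
    let a≡a′ , dk≡dk′ = ∷-injective (π-injective (begin
          π (a ∷ decode k)                                        ≡⟨ head∷tail _ ⟨
          head (π (a ∷ decode k)) ∷ tail (π (a ∷ decode k))       ≡⟨ cong₂ _∷_ (cong proj₁ eq) (encode-injective (cong proj₂ eq)) ⟩
          head (π (a′ ∷ decode k′)) ∷ tail (π (a′ ∷ decode k′))   ≡⟨ head∷tail _ ⟩
          π (a′ ∷ decode k′)                                      ∎))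
    in  cong₂ _,_ a≡a′ (decode-injective dk≡dk′)
    where open ≡-Reasoning

  open König π̂ π̂-injective using (target; könig)

  σ = proj₁ könig
  σ-leftProper = proj₁ (proj₂ könig)
  σ-proper = proj₂ (proj₂ könig)

  colour : Point s (suc (suc m)) → Fin s
  colour (x ∷ u) = InverseOf.f⁻¹ (σ-leftProper (encode u)) x

  route : Fin s → Point s (suc m) → Point s (suc m)
  route c = decode ∘ target σ c ∘ encode

  route-injective : ∀ c → Injective _≡_ _≡_ (route c)
  route-injective c eq = encode-injective (σ-proper c (decode-injective eq))

  restore : Point s (suc (suc m)) → Fin s
  restore (c ∷ v) = let k = InverseOf.f⁻¹ (σ-proper c) (encode v) in head (π (σ k c ∷ decode k))

  restore∘route∘colour : ∀ X → let Y = colour X ∷ tail X ; Z = head Y ∷ route (head Y) (tail Y) in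
                                restore Z ∷ tail Z ≡ π X
  restore∘route∘colour (x ∷ u) = begin
    restore (c ∷ route c u) ∷ route c u       ≡⟨ cong₂ _∷_ restored routed ⟩
    head (π (x ∷ u)) ∷ tail (π (x ∷ u))       ≡⟨ head∷tail (π (x ∷ u)) ⟩
    π (x ∷ u)                                 ∎
    where
    open ≡-Reasoning
    k = encode u
    c = colour (x ∷ u)
    coloured : π (σ k c ∷ decode k) ≡ π (x ∷ u)
    coloured = cong π (cong₂ _∷_ (InverseOf.f∘f⁻¹ (σ-leftProper k) x) (decode-encode u))
    routed : route c u ≡ tail (π (x ∷ u))
    routed = trans (decode-encode _) (cong tail coloured)
    restored : restore (c ∷ route c u) ≡ head (π (x ∷ u))
    restored = begin
      restore (c ∷ route c u)       ≡⟨ cong (λ k′ → head (π (σ k′ c ∷ decode k′)))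
                                             (trans (cong (InverseOf.f⁻¹ (σ-proper c)) (encode-decode (target σ c k)))
                                                    (InverseOf.f⁻¹∘f (σ-proper c) k)) ⟩
      head (π (σ k c ∷ decode k))   ≡⟨ cong head coloured ⟩
      head (π (x ∷ u))              ∎

benes : ∀ {s} .{{_ : NonZero s}} m (π : Point s (suc m) → Point s (suc m)) → Injective _≡_ _≡_ π →
        InSitu (benesSignature m) π
benes zero π π-injective = head ∘ π , id , (λ _ → refl) , λ X → single (π X) X
  where
  single : ∀ {s} (Y X : Point s 1) → Y ≡ step ((λ _ → head Y) , zero) X
  single (y ∷ []) (x ∷ []) = refl
benes (suc m) π π-injective =
  InSitu-resp restore∘route∘colour (InSitu-∘ (InSitu-head colour)
    (InSitu-∘ (InSitu-lift route (λ c → benes m (route c) (route-injective c))) (InSitu-head restore)))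
  where open BenesStep π π-injective

benes-mirrored : ∀ {s} .{{_ : NonZero s}} m (π : Point s (suc m) → Point s (suc m)) → Injective _≡_ _≡_ π →
                 InSitu (map opposite (benesSignature m)) π
benes-mirrored m π π-injective = InSitu-resp unmirror (InSitu-mirror (benes m (mirror ∘ π ∘ mirror) mirrored-injective))
  where
  mirror-injective : ∀ {X Y} → mirror X ≡ mirror Y → X ≡ Y
  mirror-injective {X} {Y} eq = trans (sym (mirror-involutive X)) (trans (cong mirror eq) (mirror-involutive Y))
  mirrored-injective : Injective _≡_ _≡_ (mirror ∘ π ∘ mirror)
  mirrored-injective = mirror-injective ∘ π-injective ∘ mirror-injective
  unmirror : ∀ X → mirror (mirror (π (mirror (mirror X)))) ≡ π X
  unmirror X = trans (mirror-involutive _) (cong π (mirror-involutive X))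

-- Index maps with unit increments

record UnitMonotone (h : ℕ → ℕ) : Set where
  field
    fixes-zero : h 0 ≡ 0
    mono-step  : ∀ j → h j ≤ h (suc j)
    unit-step  : ∀ j → h (suc j) ≤ suc (h j)

  mono : ∀ i d → h i ≤ h (d + i)
  mono i zero    = ≤-refl
  mono i (suc d) = ≤-trans (mono i d) (mono-step (d + i))

  unit-increments : ∀ i d → h (d + i) ≤ d + h i
  unit-increments i zero    = ≤-refl
  unit-increments i (suc d) = ≤-trans (unit-step (d + i)) (s≤s (unit-increments i d))

+-∸-≤ : ∀ a b c → b + a ∸ c ≤ a ∸ c + b
+-∸-≤ a b c = m≤n+o⇒m∸n≤o (b + a) c (begin
  b + a             ≡⟨ +-comm b a ⟩
  a + b             ≤⟨ +-monoˡ-≤ b (m≤n+m∸n a c) ⟩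
  c + (a ∸ c) + b   ≡⟨ +-assoc c (a ∸ c) b ⟩
  c + (a ∸ c + b)   ∎)
  where open ≤-Reasoning

module _ {s′ : ℕ} {h : ℕ → ℕ} (h-unitMonotone : UnitMonotone h) where

  private
    s = suc s′
  open UnitMonotone h-unitMonotone

  -- The digit c = h (x + k * s) % s determines h (x + k * s) / s from k alone,
  -- because h (k * s) ≤ h (x + k * s) ≤ h (k * s) + s′.
  carry : Fin s → ℕ → ℕ
  carry c k = (h (k * s) ∸ toℕ c + s′) / s

  carry-unitMonotone : ∀ c → UnitMonotone (carry c)
  carry-unitMonotone c = record
    { fixes-zero = begin-equality
        (h 0 ∸ toℕ c + s′) / s ≡⟨ cong (λ a → (a ∸ toℕ c + s′) / s) fixes-zero ⟩
        (0 ∸ toℕ c + s′) / s   ≡⟨ cong (λ a → (a + s′) / s) (0∸n≡0 (toℕ c)) ⟩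
        s′ / s                 ≡⟨ m<n⇒m/n≡0 (n<1+n s′) ⟩
        0                      ∎
    ; mono-step = λ k → /-monoˡ-≤ s (+-monoˡ-≤ s′ (∸-monoˡ-≤ (toℕ c) (mono (k * s) s)))
    ; unit-step = λ k → let a = h (k * s) ∸ toℕ c + s′ in begin
        (h (s + k * s) ∸ toℕ c + s′) / s   ≤⟨ /-monoˡ-≤ s (+-monoˡ-≤ s′ (∸-monoˡ-≤ (toℕ c) (unit-increments (k * s) s))) ⟩
        (s + h (k * s) ∸ toℕ c + s′) / s   ≤⟨ /-monoˡ-≤ s (+-monoˡ-≤ s′ (+-∸-≤ (h (k * s)) s (toℕ c))) ⟩
        (h (k * s) ∸ toℕ c + s + s′) / s   ≡⟨ cong (_/ s) (xy∙z≈xz∙y (h (k * s) ∸ toℕ c) s s′) ⟩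
        (a + s) / s                        ≡⟨ [a+s]/s≡1+a/s s a ⟩
        suc (a / s)                        ∎
    }
    where open ≤-Reasoning

  digit : ℕ → Fin s
  digit j = fromℕ< (m%n<n j s)

  carry-digit : ∀ {x} k → x < s → carry (digit (h (x + k * s))) k ≡ h (x + k * s) / s
  carry-digit {x} k x<s = begin-equality
    carry (digit b) k  ≡⟨ cong (λ r → (a ∸ r + s′) / s) (toℕ-fromℕ< (m%n<n b s)) ⟩
    (a ∸ r + s′) / s   ≡⟨ /-between s lower upper ⟩
    q                  ∎
    where
    open ≤-Reasoning
    a = h (k * s)
    b = h (x + k * s)
    r = b % s
    q = b / s
    b≡r+q*s : b ≡ r + q * s
    b≡r+q*s = m≡m%n+[m/n]*n b s
    b∸r≡q*s : b ∸ r ≡ q * s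
    b∸r≡q*s = trans (cong (_∸ r) b≡r+q*s) (m+n∸m≡n r (q * s))
    lower : q * s ≤ a ∸ r + s′
    lower = begin
      q * s          ≡⟨ b∸r≡q*s ⟨
      b ∸ r          ≤⟨ ∸-monoˡ-≤ r (≤-trans (unit-increments (k * s) x) (+-monoˡ-≤ a (s≤s⁻¹ x<s))) ⟩
      s′ + a ∸ r     ≤⟨ +-∸-≤ a s′ r ⟩
      a ∸ r + s′     ∎
    upper : a ∸ r + s′ < suc q * s
    upper = begin-strict
      a ∸ r + s′     ≤⟨ +-monoˡ-≤ s′ (∸-monoˡ-≤ r (mono (k * s) x)) ⟩
      b ∸ r + s′     ≡⟨ cong (_+ s′) b∸r≡q*s ⟩
      q * s + s′     <⟨ +-monoʳ-< (q * s) (n<1+n s′) ⟩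
      q * s + s      ≡⟨ +-comm (q * s) s ⟩
      suc q * s      ∎

ascending : ∀ n → List (Fin n)
ascending zero    = []
ascending (suc n) = zero ∷ map suc (ascending n)

InSitu-indexMap : ∀ {s′} n {h} → UnitMonotone h → InSitu (ascending n) (fromIndex {suc s′} n ∘ h ∘ index)
InSitu-indexMap zero    h-um [] = refl
InSitu-indexMap {s′} (suc n) {h} h-um =
  InSitu-resp correct (InSitu-∘ (InSitu-head (digit h-um ∘ h ∘ index))
                                 (InSitu-lift rest (λ c → InSitu-indexMap n (carry-unitMonotone h-um c))))
  where
  rest : Fin (suc s′) → Point (suc s′) n → Point (suc s′) n
  rest c = fromIndex n ∘ carry h-um c ∘ index
  correct : ∀ X → let c = digit h-um (h (index X)) in c ∷ rest c (tail X) ≡ fromIndex (suc n) (h (index X))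
  correct (x ∷ u) = cong (digit h-um (h (index (x ∷ u))) ∷_) (cong (fromIndex n) (carry-digit h-um (index u) (toℕ<n x)))

-- The factorisation E = F ∘ I ∘ G

+*-injective : ∀ {N} (k : Fin N → ℕ) → Injective _≡_ _≡_ (λ x → toℕ x + k x * N)
+*-injective {suc N′} k {x} {y} eq = toℕ-injective (begin
  toℕ x                              ≡⟨ [r+q*s]%s≡r (suc N′) (k x) (toℕ<n x) ⟨
  (toℕ x + k x * suc N′) % suc N′    ≡⟨ cong (_% suc N′) eq ⟩
  (toℕ y + k y * suc N′) % suc N′    ≡⟨ [r+q*s]%s≡r (suc N′) (k y) (toℕ<n y) ⟩
  toℕ y                              ∎)
  where open ≡-Reasoning

+*-mono-< : ∀ {N} (k : Fin N → ℕ) {x y} → k y < k x → toℕ y + k y * N < toℕ x + k x * N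
+*-mono-< {N} k {x} {y} ky<kx = begin-strict
  toℕ y + k y * N   <⟨ +-monoˡ-< (k y * N) (toℕ<n y) ⟩
  suc (k y) * N     ≤⟨ *-monoˡ-≤ N ky<kx ⟩
  k x * N           ≤⟨ m≤n+m (k x * N) (toℕ x) ⟩
  toℕ x + k x * N   ∎
  where open ≤-Reasoning

module Rank {N} (κ : Fin N → ℕ) (κ-injective : Injective _≡_ _≡_ κ) where

  below : ∀ x → Decidable (λ y → κ y < κ x)
  below x y = κ y <? κ x

  rank : Fin N → ℕ
  rank x = count (below x)

  rank-mono-≤ : ∀ {x y} → κ y ≤ κ x → rank y ≤ rank x
  rank-mono-≤ {x} {y} κy≤κx = count-mono (below y) (below x) (λ κz<κy → <-≤-trans κz<κy κy≤κx)

  rank-mono-< : ∀ {x y} → κ y < κ x → rank y < rank x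
  rank-mono-< {x} {y} κy<κx = count-mono-< (below y) (below x) (λ κz<κy → <-trans κz<κy κy<κx) y κy<κx (n≮n (κ y))

  rank< : ∀ x → rank x < N
  rank< x = count-< (below x) x (n≮n (κ x))

  rank-injective : Injective _≡_ _≡_ rank
  rank-injective {x} {y} rx≡ry with <-cmp (κ x) (κ y)
  ... | tri< κx<κy _ _ = contradiction rx≡ry (<⇒≢ (rank-mono-< κx<κy))
  ... | tri≈ _ κx≡κy _ = κ-injective κx≡κy
  ... | tri> _ _ κy<κx = contradiction (sym rx≡ry) (<⇒≢ (rank-mono-< κy<κx))

  rankᶠ : Fin N → Fin N
  rankᶠ x = fromℕ< (rank< x)

  toℕ-rankᶠ : ∀ x → toℕ (rankᶠ x) ≡ rank x
  toℕ-rankᶠ x = toℕ-fromℕ< (rank< x)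

  rankᶠ-injective : Injective _≡_ _≡_ rankᶠ
  rankᶠ-injective {x} {y} eq = rank-injective (trans (sym (toℕ-rankᶠ x)) (trans (cong toℕ eq) (toℕ-rankᶠ y)))

clamp : ∀ {N′} → ℕ → Fin (suc N′)
clamp {N′} j = fromℕ< (s≤s (m⊓n≤n j N′))

module _ {N′ : ℕ} where

  toℕ-clamp : ∀ j → toℕ (clamp {N′} j) ≡ j ⊓ N′
  toℕ-clamp j = toℕ-fromℕ< (s≤s (m⊓n≤n j N′))

  clamp-toℕ : ∀ (p : Fin (suc N′)) → clamp (toℕ p) ≡ p
  clamp-toℕ p = toℕ-injective (trans (toℕ-clamp (toℕ p)) (m≤n⇒m⊓n≡m (s≤s⁻¹ (toℕ<n p))))

  clamp-unitMonotone : ∀ {f : Fin (suc N′) → ℕ} → (∀ p → toℕ p ≡ 0 → f p ≡ 0) →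
                       (∀ p p′ → toℕ p′ ≡ suc (toℕ p) → f p ≤ f p′ × f p′ ≤ suc (f p)) →
                       UnitMonotone (f ∘ clamp)
  clamp-unitMonotone {f} f-zero f-step = record
    { fixes-zero = f-zero (clamp 0) (toℕ-clamp 0)
    ; mono-step  = proj₁ ∘ increment
    ; unit-step  = proj₂ ∘ increment
    }
    where
    increment : ∀ j → f (clamp j) ≤ f (clamp (suc j)) × f (clamp (suc j)) ≤ suc (f (clamp j))
    increment j with j <? N′
    ... | yes j<N′ = f-step (clamp j) (clamp (suc j)) (begin
      toℕ (clamp (suc j))   ≡⟨ toℕ-clamp (suc j) ⟩
      suc j ⊓ N′            ≡⟨ m≤n⇒m⊓n≡m j<N′ ⟩
      suc j                 ≡⟨ cong suc (m≤n⇒m⊓n≡m (<⇒≤ j<N′)) ⟨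
      suc (j ⊓ N′)          ≡⟨ cong suc (toℕ-clamp j) ⟨
      suc (toℕ (clamp j))   ∎)
      where open ≡-Reasoning
    ... | no j≮N′ = subst (λ p → f (clamp j) ≤ f p × f p ≤ suc (f (clamp j))) (sym saturated) (≤-refl , n≤1+n _)
      where
      saturated : clamp (suc j) ≡ clamp j
      saturated = toℕ-injective (begin
        toℕ (clamp (suc j))   ≡⟨ toℕ-clamp (suc j) ⟩
        suc j ⊓ N′            ≡⟨ m≥n⇒m⊓n≡n (≤-trans (≮⇒≥ j≮N′) (n≤1+n j)) ⟩
        N′                    ≡⟨ m≥n⇒m⊓n≡n (≮⇒≥ j≮N′) ⟨
        j ⊓ N′                ≡⟨ toℕ-clamp j ⟨
        toℕ (clamp j)         ∎)
        where open ≡-Reasoning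

record Factorisation {N} (e : Fin N → Fin N) : Set where
  field
    F G I          : Fin N → Fin N
    F-injective    : Injective _≡_ _≡_ F
    G-injective    : Injective _≡_ _≡_ G
    h              : ℕ → ℕ
    h-unitMonotone : UnitMonotone h
    toℕ-I          : ∀ p → toℕ (I p) ≡ h (toℕ p)
    factorises     : ∀ k → F (I (G k)) ≡ e k

-- G sorts the inputs by their image, and the values are numbered image values first, in
-- increasing order; I then maps the position of an input to the number of its image.
module Factorise {N′} (e : Fin (suc N′) → Fin (suc N′)) where

  private
    N = suc N′

  Image : Fin N → Set
  Image v = ∃[ x ] e x ≡ v

  image? : Decidable Image
  image? v = any? (λ x → e x ≟ v)

  inputKey valueKey : Fin N → ℕ
  inputKey x = toℕ x + toℕ (e x) * N
  valueKey v = toℕ v + 𝟙 (¬? (image? v)) * N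

  module Inputs = Rank inputKey (+*-injective (toℕ ∘ e))
  module Values = Rank valueKey (+*-injective (λ v → 𝟙 (¬? (image? v))))

  open InverseOf Inputs.rankᶠ-injective using () renaming (f⁻¹ to G⁻¹; f∘f⁻¹ to G∘G⁻¹; f⁻¹∘f to G⁻¹∘G)
  open InverseOf Values.rankᶠ-injective using () renaming (f⁻¹ to F; f⁻¹∘f to F∘rankᶠ; f⁻¹-injective to F-injective)

  I : Fin N → Fin N
  I = Values.rankᶠ ∘ e ∘ G⁻¹

  rank-G⁻¹ : ∀ p → Inputs.rank (G⁻¹ p) ≡ toℕ p
  rank-G⁻¹ p = trans (sym (Inputs.toℕ-rankᶠ (G⁻¹ p))) (cong toℕ (G∘G⁻¹ p))

  valueKey-image : ∀ x → valueKey (e x) ≡ toℕ (e x)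
  valueKey-image x = trans (cong (λ b → toℕ (e x) + b * N) (𝟙-no (¬? (image? (e x))) (λ ∉image → ∉image (x , refl))))
                           (+-identityʳ (toℕ (e x)))

  valueKey-nonimage : ∀ {w} → ¬ Image w → N ≤ valueKey w
  valueKey-nonimage {w} ∉image = subst (λ b → N ≤ toℕ w + b * N) (sym (𝟙-yes (¬? (image? w)) ∉image))
                                       (≤-trans (≤-reflexive (sym (*-identityˡ N))) (m≤n+m (1 * N) (toℕ w)))

  earlier-by-value : ∀ {x y} → toℕ (e y) < toℕ (e x) → Inputs.rank y < Inputs.rank x
  earlier-by-value ey<ex = Inputs.rank-mono-< (+*-mono-< (toℕ ∘ e) ey<ex)

  below-image : ∀ {w x} → valueKey w < valueKey (e x) → ∃[ y ] e y ≡ w × toℕ (e y) < toℕ (e x)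
  below-image {w} {x} lt with image? w
  ... | yes (y , refl) = y , refl , subst₂ _<_ (valueKey-image y) (valueKey-image x) lt
  ... | no ∉image      = contradiction (≤-trans (valueKey-nonimage ∉image) (<⇒≤ lt))
                                       (<⇒≱ (subst (_< N) (sym (valueKey-image x)) (toℕ<n (e x))))

  I-zero : ∀ p → toℕ p ≡ 0 → toℕ (I p) ≡ 0
  I-zero p p≡0 = trans (Values.toℕ-rankᶠ (e (G⁻¹ p))) (count-none (Values.below (e (G⁻¹ p))) none)
    where
    none : ∀ w → ¬ valueKey w < valueKey (e (G⁻¹ p))
    none w lt = let y , _ , ey<ex = below-image lt
                in  n≮0 (subst (Inputs.rank y <_) (trans (rank-G⁻¹ p) p≡0) (earlier-by-value ey<ex))

  I-step : ∀ p p′ → toℕ p′ ≡ suc (toℕ p) → toℕ (I p) ≤ toℕ (I p′) × toℕ (I p′) ≤ suc (toℕ (I p))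
  I-step p p′ p′≡1+p = subst₂ (λ a b → a ≤ b × b ≤ suc a) (sym (Values.toℕ-rankᶠ (e x))) (sym (Values.toℕ-rankᶠ (e x′)))
                              (mono , unit)
    where
    x  = G⁻¹ p
    x′ = G⁻¹ p′
    rx′≡1+rx : Inputs.rank x′ ≡ suc (Inputs.rank x)
    rx′≡1+rx = trans (rank-G⁻¹ p′) (trans p′≡1+p (cong suc (sym (rank-G⁻¹ p))))
    ex≤ex′ : toℕ (e x) ≤ toℕ (e x′)
    ex≤ex′ = ≮⇒≥ λ ex′<ex → <⇒≱ (earlier-by-value ex′<ex) (≤-trans (n≤1+n _) (≤-reflexive (sym rx′≡1+rx)))
    mono : Values.rank (e x) ≤ Values.rank (e x′)
    mono = Values.rank-mono-≤ (subst₂ _≤_ (sym (valueKey-image x)) (sym (valueKey-image x′)) ex≤ex′)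
    split : ∀ {w} → valueKey w < valueKey (e x′) → valueKey w < valueKey (e x) ⊎ e x ≡ w
    split lt with below-image lt
    ... | y , refl , ey<ex′ with <-cmp (toℕ (e y)) (toℕ (e x))
    ...   | tri< ey<ex _ _ = inj₁ (subst₂ _<_ (sym (valueKey-image y)) (sym (valueKey-image x)) ey<ex)
    ...   | tri≈ _ ey≡ex _ = inj₂ (toℕ-injective (sym ey≡ex))
    ...   | tri> _ _ ex<ey = contradiction (s≤s⁻¹ (subst (Inputs.rank y <_) rx′≡1+rx (earlier-by-value ey<ex′)))
                                           (<⇒≱ (earlier-by-value ex<ey))
    unit : Values.rank (e x′) ≤ suc (Values.rank (e x))
    unit = count-≤-insert (Values.below (e x′)) (Values.below (e x)) (e x) split

  factorisation : Factorisation e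
  factorisation = record
    { F              = F
    ; G              = Inputs.rankᶠ
    ; I              = I
    ; F-injective    = F-injective
    ; G-injective    = Inputs.rankᶠ-injective
    ; h              = toℕ ∘ I ∘ clamp
    ; h-unitMonotone = clamp-unitMonotone I-zero I-step
    ; toℕ-I          = λ p → cong (toℕ ∘ I) (sym (clamp-toℕ p))
    ; factorises     = λ k → trans (cong (F ∘ Values.rankᶠ ∘ e) (G⁻¹∘G k)) (F∘rankᶠ (e k))
    }

factorisation : ∀ {N} (e : Fin N → Fin N) → Factorisation e
factorisation {zero}   e = record
  { F = λ () ; G = λ () ; I = λ () ; F-injective = λ { {()} } ; G-injective = λ { {()} }
  ; h = λ _ → 0 ; h-unitMonotone = record { fixes-zero = refl ; mono-step = λ _ → z≤n ; unit-step = λ _ → z≤n }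
  ; toℕ-I = λ () ; factorises = λ () }
factorisation {suc N′} e = Factorise.factorisation e

module PointFactorisation {s} .{{_ : NonZero s}} {n} (E : Point s n → Point s n) where

  open Encoding n
  open Factorisation (factorisation (encode ∘ E ∘ decode)) public

  Gₚ Iₚ Fₚ : Point s n → Point s n
  Gₚ = decode ∘ G ∘ encode
  Iₚ = fromIndex n ∘ h ∘ index
  Fₚ = decode ∘ F ∘ encode

  Gₚ-injective : Injective _≡_ _≡_ Gₚ
  Gₚ-injective = encode-injective ∘ G-injective ∘ decode-injective

  Fₚ-injective : Injective _≡_ _≡_ Fₚ
  Fₚ-injective = encode-injective ∘ F-injective ∘ decode-injective

  Fₚ∘Iₚ∘Gₚ : ∀ X → Fₚ (Iₚ (Gₚ X)) ≡ E X
  Fₚ∘Iₚ∘Gₚ X = begin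
    decode (F (encode (fromIndex n (h (index (decode (G k)))))))  ≡⟨ cong (λ j → decode (F (encode (fromIndex n (h j))))) (index-decode (G k)) ⟩
    decode (F (encode (fromIndex n (h (toℕ (G k))))))            ≡⟨ cong (λ j → decode (F (encode (fromIndex n j)))) (toℕ-I (G k)) ⟨
    decode (F (encode (decode (I (G k)))))                        ≡⟨ cong (decode ∘ F) (encode-decode (I (G k))) ⟩
    decode (F (I (G k)))                                          ≡⟨ cong decode (factorises k) ⟩
    decode (encode (E (decode k)))                                ≡⟨ decode-encode _ ⟩
    E (decode k)                                                  ≡⟨ cong E (decode-encode X) ⟩
    E X                                                           ∎
    where
    open ≡-Reasoning
    k = encode X

ι : ∀ {n} → Fin n → ℕ
ι i = suc (toℕ i)

up : ℕ → ℕ → List ℕ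
up a zero    = []
up a (suc k) = a ∷ up (suc a) k

range-up : ∀ a b → range a b ≡ up a (suc b ∸ a)
range-up a b = trans (map-applyUpTo id (a +_) (suc b ∸ a)) (applyUpTo-up a (suc b ∸ a) (λ _ → refl))
  where
  applyUpTo-up : ∀ a k {f} → (∀ i → f i ≡ a + i) → applyUpTo f k ≡ up a k
  applyUpTo-up a zero    f≗a+ = refl
  applyUpTo-up a (suc k) f≗a+ = cong₂ _∷_ (trans (f≗a+ 0) (+-identityʳ a))
                                          (applyUpTo-up (suc a) k (λ i → trans (f≗a+ (suc i)) (+-suc a i)))

up-∷ʳ : ∀ a k → up a (suc k) ≡ up a k ∷ʳ (a + k)
up-∷ʳ a zero    = cong (_∷ []) (sym (+-identityʳ a))
up-∷ʳ a (suc k) = cong (a ∷_) (trans (up-∷ʳ (suc a) k) (cong (up (suc a) k ∷ʳ_) (sym (+-suc a k))))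

reverse-up : ∀ a k → reverse (up a (suc k)) ≡ (a + k) ∷ reverse (up a k)
reverse-up a k = trans (cong reverse (up-∷ʳ a k)) (reverse-++ (up a k) (a + k ∷ []))

map-suc-up : ∀ a k → map suc (up a k) ≡ up (suc a) k
map-suc-up a zero    = refl
map-suc-up a (suc k) = cong (suc a ∷_) (map-suc-up (suc a) k)

length-up : ∀ a k → length (up a k) ≡ k
length-up a zero    = refl
length-up a (suc k) = cong suc (length-up (suc a) k)

map-ι-suc : ∀ {n} (σ : List (Fin n)) → map ι (map suc σ) ≡ map suc (map ι σ)
map-ι-suc σ = trans (sym (map-∘ σ)) (map-∘ σ)

ι-ascending : ∀ n → map ι (ascending n) ≡ up 1 n
ι-ascending zero    = refl
ι-ascending (suc n) = cong (1 ∷_) (trans (map-ι-suc (ascending n)) (trans (cong (map suc) (ι-ascending n)) (map-suc-up 1 n)))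

ι-benes : ∀ m → map ι (benesSignature m) ≡ up 1 (suc m) ++ reverse (up 1 m)
ι-benes zero    = refl
ι-benes (suc m) = cong (1 ∷_) (begin
  map ι (map suc (benesSignature m) ∷ʳ zero)                      ≡⟨ map-++ ι (map suc (benesSignature m)) (zero ∷ []) ⟩
  map ι (map suc (benesSignature m)) ∷ʳ 1                         ≡⟨ cong (_∷ʳ 1) (trans (map-ι-suc (benesSignature m)) (cong (map suc) (ι-benes m))) ⟩
  map suc (up 1 (suc m) ++ reverse (up 1 m)) ∷ʳ 1                 ≡⟨ cong (_∷ʳ 1) (map-++ suc (up 1 (suc m)) (reverse (up 1 m))) ⟩
  (map suc (up 1 (suc m)) ++ map suc (reverse (up 1 m))) ∷ʳ 1     ≡⟨ cong₂ (λ xs ys → (xs ++ ys) ∷ʳ 1) (map-suc-up 1 (suc m))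
                                                                          (trans (reverse-map suc (up 1 m)) (cong reverse (map-suc-up 1 m))) ⟩
  (up 2 (suc m) ++ reverse (up 2 m)) ∷ʳ 1                         ≡⟨ ++-assoc (up 2 (suc m)) (reverse (up 2 m)) (1 ∷ []) ⟩
  up 2 (suc m) ++ reverse (up 2 m) ∷ʳ 1                           ≡⟨ cong (up 2 (suc m) ++_) (unfold-reverse 1 (up 2 m)) ⟨
  up 2 (suc m) ++ reverse (up 1 (suc m))                          ∎)
  where open ≡-Reasoning

ι-benes-mirrored : ∀ m → map (ι ∘ opposite) (benesSignature m) ≡ reverse (up 1 (suc m)) ++ up 2 m
ι-benes-mirrored zero    = refl
ι-benes-mirrored (suc m) = begin
  ι (opposite {suc (suc m)} zero) ∷ map (ι ∘ opposite) (map suc (benesSignature m) ∷ʳ zero)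
    ≡⟨ cong₂ _∷_ ι-last (map-++ (ι ∘ opposite) (map suc (benesSignature m)) (zero ∷ [])) ⟩
  suc (suc m) ∷ (map (ι ∘ opposite) (map suc (benesSignature m)) ∷ʳ ι (opposite {suc (suc m)} zero))
    ≡⟨ cong₂ (λ xs x → suc (suc m) ∷ (xs ∷ʳ x)) (trans (sym (map-∘ (benesSignature m))) (trans
         (map-cong (cong suc ∘ opposite-suc) (benesSignature m)) (ι-benes-mirrored m))) ι-last ⟩
  suc (suc m) ∷ ((reverse (up 1 (suc m)) ++ up 2 m) ∷ʳ suc (suc m))
    ≡⟨ cong (suc (suc m) ∷_) (++-assoc (reverse (up 1 (suc m))) (up 2 m) (suc (suc m) ∷ [])) ⟩
  suc (suc m) ∷ (reverse (up 1 (suc m)) ++ up 2 m ∷ʳ suc (suc m))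
    ≡⟨ cong₂ _++_ (reverse-up 1 (suc m)) (up-∷ʳ 2 m) ⟨
  reverse (up 1 (suc (suc m))) ++ up 2 (suc m)
    ∎
  where
  open ≡-Reasoning
  ι-last : ι (opposite {suc (suc m)} zero) ≡ suc (suc m)
  ι-last = cong suc (toℕ-fromℕ (suc m))

benes-∷ʳ : ∀ m → ∃[ σ ] benesSignature m ≡ σ ∷ʳ zero
benes-∷ʳ zero    = [] , refl
benes-∷ʳ (suc m) = zero ∷ map suc (benesSignature m) , refl

benes-∷ : ∀ m → ∃[ τ ] benesSignature m ≡ zero ∷ τ
benes-∷ zero    = [] , refl
benes-∷ (suc m) = map suc (benesSignature m) ∷ʳ zero , refl

ascending-∷ʳ : ∀ m → ascending (suc m) ≡ map inject₁ (ascending m) ∷ʳ fromℕ m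
ascending-∷ʳ zero    = refl
ascending-∷ʳ (suc m) = cong (zero ∷_) (begin
  map suc (ascending (suc m))                            ≡⟨ cong (map suc) (ascending-∷ʳ m) ⟩
  map suc (map inject₁ (ascending m) ∷ʳ fromℕ m)         ≡⟨ map-++ suc (map inject₁ (ascending m)) (fromℕ m ∷ []) ⟩
  map suc (map inject₁ (ascending m)) ∷ʳ fromℕ (suc m)   ≡⟨ cong (_∷ʳ fromℕ (suc m)) (trans (sym (map-∘ (ascending m))) (map-∘ (ascending m))) ⟩
  map inject₁ (map suc (ascending m)) ∷ʳ fromℕ (suc m)   ∎)
  where open ≡-Reasoning

targetSignature-up : ∀ m → targetSignature (suc m) ≡ up 1 (suc m) ++ reverse (up 1 m) ++ up 2 m ++ reverse (up 1 m) ++ up 2 m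
targetSignature-up m = cong₂ _++_ (range-up 1 (suc m))
  (cong₂ (λ D B → D ++ B ++ D ++ B) (cong reverse (range-up 1 m)) (range-up 2 (suc m)))

length-targetSignature : ∀ m → length (targetSignature (suc m)) ≡ 5 * suc m ∸ 4
length-targetSignature m = begin
  length (targetSignature (suc m))                             ≡⟨ cong length (targetSignature-up m) ⟩
  length (up 1 (suc m) ++ D ++ up 2 m ++ D ++ up 2 m)          ≡⟨ length-++ (up 1 (suc m)) ⟩
  length (up 1 (suc m)) + length (D ++ up 2 m ++ D ++ up 2 m)  ≡⟨ cong₂ _+_ (length-up 1 (suc m)) (length-++ D) ⟩
  suc m + (length D + length (up 2 m ++ D ++ up 2 m))          ≡⟨ cong₂ (λ x y → suc m + (x + y)) |D| (length-++ (up 2 m)) ⟩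
  suc m + (m + (length (up 2 m) + length (D ++ up 2 m)))       ≡⟨ cong₂ (λ x y → suc m + (m + (x + y))) (length-up 2 m) (length-++ D) ⟩
  suc m + (m + (m + (length D + length (up 2 m))))             ≡⟨ cong₂ (λ x y → suc m + (m + (m + (x + y)))) |D| (length-up 2 m) ⟩
  suc m + (m + (m + (m + m)))                                  ≡⟨ cong (λ x → suc (m + (m + (m + (m + x))))) (+-identityʳ m) ⟨
  suc (5 * m)                                                  ≡⟨ cong (_∸ 4) (*-suc 5 m) ⟨
  5 * suc m ∸ 4                                                ∎
  where
  open ≡-Reasoning
  D = reverse (up 1 m)
  |D| : length D ≡ m
  |D| = trans (length-reverse (up 1 m)) (length-up 1 m)

merged-signature : ∀ {m} {g i f : List ℕ} → g ∷ʳ 1 ≡ up 1 (suc m) ++ reverse (up 1 m) → i ∷ʳ suc m ≡ up 1 (suc m) →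
                   suc m ∷ f ≡ reverse (up 1 (suc m)) ++ up 2 m → (g ++ i) ++ suc m ∷ f ≡ targetSignature (suc m)
merged-signature {m} {g} {i} {f} g∷ʳ1 i∷ʳ1+m 1+m∷f = begin
  (g ++ i) ++ suc m ∷ f                          ≡⟨ ++-assoc g i (suc m ∷ f) ⟩
  g ++ (i ++ suc m ∷ f)                          ≡⟨ cong (g ++_) (++-assoc i (suc m ∷ []) f) ⟨
  g ++ ((i ∷ʳ suc m) ++ f)                       ≡⟨ cong (λ xs → g ++ (xs ++ f)) i∷ʳ1+m ⟩
  g ++ (1 ∷ up 2 m ++ f)                         ≡⟨ ++-assoc g (1 ∷ []) (up 2 m ++ f) ⟨
  (g ∷ʳ 1) ++ up 2 m ++ f                        ≡⟨ cong₂ (λ xs ys → xs ++ up 2 m ++ ys) g∷ʳ1 f≡ ⟩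
  (up 1 (suc m) ++ D) ++ up 2 m ++ D ++ up 2 m   ≡⟨ ++-assoc (up 1 (suc m)) D _ ⟩
  up 1 (suc m) ++ D ++ up 2 m ++ D ++ up 2 m     ≡⟨ targetSignature-up m ⟨
  targetSignature (suc m)                        ∎
  where
  open ≡-Reasoning
  D = reverse (up 1 m)
  f≡ : f ≡ D ++ up 2 m
  f≡ = ∷-injectiveʳ (trans 1+m∷f (cong (_++ up 2 m) (reverse-up 1 m)))

InSitu-five-stage : ∀ {s} m {G I F : Point s (suc m) → Point s (suc m)} →
                    InSitu (benesSignature m) G → InSitu (ascending (suc m)) I → InSitu (map opposite (benesSignature m)) F →
                    Σ[ σ ∈ List (Fin (suc m)) ] map ι σ ≡ targetSignature (suc m) × InSitu σ (F ∘ I ∘ G)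
InSitu-five-stage m {G} {I} {F} G-in-situ I-in-situ F-in-situ =
  (σG ++ σI) ++ fromℕ m ∷ map opposite τF , signature-merged , InSitu-merge GI F′
  where
  σG = proj₁ (benes-∷ʳ m)
  σI = map inject₁ (ascending m)
  τF = proj₁ (benes-∷ m)
  GI : InSitu ((σG ++ σI) ∷ʳ fromℕ m) (I ∘ G)
  GI = subst (λ σ → InSitu σ (I ∘ G)) (trans (cong (σG ++_) (ascending-∷ʳ m)) (sym (++-assoc σG σI (fromℕ m ∷ []))))
             (InSitu-merge (subst (λ σ → InSitu σ G) (proj₂ (benes-∷ʳ m)) G-in-situ) I-in-situ)
  F′ : InSitu (fromℕ m ∷ map opposite τF) F
  F′ = subst (λ σ → InSitu σ F) (cong (map opposite) (proj₂ (benes-∷ m))) F-in-situ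
  ι-fromℕ : ι (fromℕ m) ≡ suc m
  ι-fromℕ = cong suc (toℕ-fromℕ m)
  signature-merged : map ι ((σG ++ σI) ++ fromℕ m ∷ map opposite τF) ≡ targetSignature (suc m)
  signature-merged = begin
    map ι ((σG ++ σI) ++ fromℕ m ∷ map opposite τF)                 ≡⟨ map-++ ι (σG ++ σI) _ ⟩
    map ι (σG ++ σI) ++ ι (fromℕ m) ∷ map ι (map opposite τF)       ≡⟨ cong₂ (λ xs x → xs ++ x ∷ map ι (map opposite τF)) (map-++ ι σG σI) ι-fromℕ ⟩
    (map ι σG ++ map ι σI) ++ suc m ∷ map ι (map opposite τF)       ≡⟨ merged-signature
      (trans (sym (map-++ ι σG (zero ∷ []))) (trans (cong (map ι) (sym (proj₂ (benes-∷ʳ m)))) (ι-benes m)))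
      (trans (cong (map ι σI ∷ʳ_) (sym ι-fromℕ)) (trans (sym (map-++ ι σI (fromℕ m ∷ [])))
             (trans (cong (map ι) (sym (ascending-∷ʳ m))) (ι-ascending (suc m)))))
      (trans (cong₂ _∷_ (sym ι-fromℕ) (sym (map-∘ τF)))
             (trans (cong (map (ι ∘ opposite)) (sym (proj₂ (benes-∷ m)))) (ι-benes-mirrored m))) ⟩
    targetSignature (suc m)                                         ∎
    where open ≡-Reasoning

InSitu-targetSignature : ∀ s m (E : Point s (suc m) → Point s (suc m)) →
                         Σ[ σ ∈ List (Fin (suc m)) ] map ι σ ≡ targetSignature (suc m) × InSitu σ E
InSitu-targetSignature zero     m E =
  let σ , σ-signature , _ = InSitu-five-stage m (InSitu-void _ id) (InSitu-void _ id) (InSitu-void _ id)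
  in  σ , σ-signature , InSitu-void σ E
InSitu-targetSignature (suc s′) m E =
  let σ , σ-signature , FIG = InSitu-five-stage m (benes m Gₚ Gₚ-injective) (InSitu-indexMap (suc m) h-unitMonotone)
                                                  (benes-mirrored m Fₚ Fₚ-injective)
  in  σ , σ-signature , InSitu-resp Fₚ∘Iₚ∘Gₚ FIG
  where open PointFactorisation E

theorem12 : (s n : ℕ) → 1 ≤ n → (E : Point s n → Point s n) →
    Σ (Program s n) (λ p →
      (length p ≡ 5 * n ∸ 4) ×
      (signature p ≡ targetSignature n) ×
      ((X : Point s n) → run p X ≡ E X))
theorem12 s (suc m) _ E =
  let σ , σ-signature , E-in-situ = InSitu-targetSignature s m E
      p , p-components , p-runs   = InSitu⇒program E-in-situ
      p-signature                 = trans (map-∘ p) (trans (cong (map ι) p-components) σ-signature)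
  in  p , trans (sym (length-map _ p)) (trans (cong length p-signature) (length-targetSignature m)) , p-signature , p-runs
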